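{- In the setting of the context (oriented Fano plane of type $(0,1,3)$, canonical composition factor $\epsilon$, operators $X_{P,D}\in\mathrm{End}(\mathbb O_{\cal F})$, bracket the commutator), let $(P,D)$ and $(P',D')$ be incident point–line pairs. Then: (1) if $P=P'$ and $D\neq D'$, then $[X_{P,D},X_{P,D'}]=0$; (2) if $P\neq P'$ and $D=D'$, then $[X_{P,D},X_{P',D}]=2\epsilon_{PP'}X_{P+P',P\wedge P'}$; (3) if $P\neq P'$, $D\neq D'$ and ($P\in D'$ or $P'\in D$), then $[X_{P,D},X_{P',D'}]=-\epsilon_{PP'}X_{P+P',P\wedge P'}$; (4) if $P\neq P'$, $D\neq D'$, $P\notin D'$ and $P'\notin D$, then $[X_{P,D},X_{P',D'}]=-\epsilon_{PP'}X_{P+P',D+D'}$, where $D+D'$ denotes the third line passing through the point $D\cap D'$.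
   Context: $\mathbb F$ is a field of characteristic not $2$. ${\cal F}$ is a Fano plane (seven points, seven lines), $P+Q$ denotes the third point on the line through distinct points $P,Q$, and $P\wedge Q$ the line through them. $\tau$ is an automorphism of ${\cal F}$ of order seven such that, writing $P_i=\tau^i(P_0)$ for $i\in\mathbb Z_7$, the lines are exactly $D_i=\{P_i,P_{i+1},P_{i+3}\}$, $i\in\mathbb Z_7$ (type $(0,1,3)$). The canonical composition factor is $\epsilon_{P_iP_j}=1$ if $j-i\equiv1,2,4\pmod 7$ and $-1$ if $j-i\equiv3,5,6\pmod 7$. $\mathbb O_{\cal F}$ is the $\mathbb F$-algebra with basis $1,e_{P}$ ($P\in{\cal F}$), unit $1$, $e_Pe_Q=\epsilon_{PQ}e_{P+Q}$ for $P\ne Q$, $e_Pe_P=-1$. For $x\in\mathbb O_{\cal F}$ let $L_x$ be left multiplication by $x$, and for distinct $P,Q$ set $e_{P,Q}=\tfrac14(L_{e_P}L_{e_Q}-L_{e_Q}L_{e_P})\in\mathrm{End}(\mathbb O_{\cal F})$. The three lines through $P_i$ are $D_i$, $D_{i-1}=\{P_{i-1},P_i,P_{i+2}\}$, $D_{i-3}=\{P_{i-3},P_{i-2},P_i\}$, and one defines $X_{P_i,D_i}=e_{P_{i+2},P_{i-1}}-e_{P_{i-3},P_{i-2}}$, $X_{P_i,D_{i-1}}=e_{P_{i-3},P_{i-2}}-e_{P_{i+1},P_{i+3}}$, $X_{P_i,D_{i-3}}=e_{P_{i+1},P_{i+3}}-e_{P_{i+2},P_{i-1}}$. Brackets are commutators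 in $\mathrm{End}(\mathbb O_{\cal F})$. An incident pair $(P,D)$ means a point $P$ and a line $D$ with $P\in D$. -}

module Defs where

open import Level using (Level; _⊔_) renaming (suc to lsuc)
open import Algebra.Bundles using (CommutativeRing)
open import Data.Bool using (Bool; true; false; if_then_else_; _∧_; _∨_; not; T)
open import Data.Fin using (Fin; zero; suc; toℕ)
open import Data.Fin.Properties using (_≟_)
open import Data.Maybe using (Maybe; just; nothing; fromMaybe)
open import Data.Nat using (ℕ)
open import Data.Nat.DivMod using (_mod_)
import Data.Nat as ℕ
open import Data.Product using (Σ; proj₁)
open import Relation.Nullary using (¬_; does)

record Field (c ℓ : Level) : Set (lsuc (c ⊔ ℓ)) where
  field
    commutativeRing : CommutativeRing c ℓ
  open CommutativeRing commutativeRing public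
  field
    0≉1     : ¬ (0# ≈ 1#)
    inverse : (x : Carrier) → ¬ (x ≈ 0#) → Σ Carrier (λ y → x * y ≈ 1#)

-- The Fano plane of type (0,1,3).  Points P_i and lines D_i are both
-- indexed by i ∈ ℤ/7 = Fin 7;  D_i = {P_i, P_{i+1}, P_{i+3}}.

Point : Set
Point = Fin 7

Line : Set
Line = Fin 7

_⊕_ : Fin 7 → ℕ → Fin 7
i ⊕ k = (toℕ i ℕ.+ k) mod 7

_==_ : Fin 7 → Fin 7 → Bool
i == j = does (i ≟ j)

incB : Point → Line → Bool
incB P D = (P == (D ⊕ 0)) ∨ ((P == (D ⊕ 1)) ∨ (P == (D ⊕ 3)))

_∈ₗ_ : Point → Line → Set
P ∈ₗ D = T (incB P D)

find : ∀ {n} → (Fin n → Bool) → Maybe (Fin n)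
find {ℕ.zero}  p = nothing
find {ℕ.suc n} p = if p zero then just zero else Data.Maybe.map suc (find (λ i → p (suc i)))

search : (Fin 7 → Bool) → Fin 7
search p = fromMaybe zero (find p)

_∧ₚ_ : Point → Point → Line
P ∧ₚ Q = search (λ D → incB P D ∧ incB Q D)

_+ₚ_ : Point → Point → Point
P +ₚ Q = search (λ R → incB R (P ∧ₚ Q) ∧ (not (R == P) ∧ not (R == Q)))

_∩ₗ_ : Line → Line → Point
D ∩ₗ D' = search (λ R → incB R D ∧ incB R D')

_+ₗ_ : Line → Line → Line
D +ₗ D' = search (λ L → incB (D ∩ₗ D') L ∧ (not (L == D) ∧ not (L == D')))

diff : Fin 7 → Fin 7 → ℕ
diff j i = ((toℕ j ℕ.+ 7) ℕ.∸ toℕ i) ℕ.% 7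

posB : ℕ → Bool
posB 1 = true
posB 2 = true
posB 4 = true
posB _ = false

-- The octonion algebra 𝕆_F over a field of characteristic ≠ 2, its
-- endomorphisms and the operators X_{P,D}.
-- Coordinates: index zero ↔ 1, index (suc i) ↔ e_{P_i}.

module Octonions {c ℓ : Level} (F : Field c ℓ)
                 (char≢2 : ¬ (Field._≈_ F (Field._+_ F (Field.1# F) (Field.1# F)) (Field.0# F))) where
  open Field F hiding (zero)

  two : Carrier
  two = 1# + 1#

  half : Carrier
  half = proj₁ (inverse two char≢2)

  quarter : Carrier
  quarter = half * half

  ε : Point → Point → Carrier
  ε P Q = if posB (diff Q P) then 1# else - 1#

  Oct : Set c
  Oct = Fin 8 → Carrier

  Σ8 : ∀ {n} → (Fin n → Carrier) → Carrier
  Σ8 {ℕ.zero}  f = 0#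
  Σ8 {ℕ.suc n} f = f zero + Σ8 (λ i → f (suc i))

  -- product of basis elements: b_a b_b = sign a b · b_{idx a b}
  idx : Fin 8 → Fin 8 → Fin 8
  idx zero    b       = b
  idx (suc P) zero    = suc P
  idx (suc P) (suc Q) = if P == Q then zero else suc (P +ₚ Q)

  sign : Fin 8 → Fin 8 → Carrier
  sign zero    b       = 1#
  sign (suc P) zero    = 1#
  sign (suc P) (suc Q) = if P == Q then - 1# else ε P Q

  eq8 : Fin 8 → Fin 8 → Bool
  eq8 a b = does (a ≟ b)

  _·_ : Oct → Oct → Oct
  (x · y) k = Σ8 (λ a → Σ8 (λ b → if eq8 (idx a b) k then sign a b * (x a * y b) else 0#))

  e : Point → Oct
  e P i = if eq8 i (suc P) then 1# else 0#

  End : Set c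
  End = Oct → Oct

  _≐_ : End → End → Set (c ⊔ ℓ)
  f ≐ g = ∀ (v : Oct) (k : Fin 8) → f v k ≈ g v k

  0E : End
  0E v k = 0#

  _−E_ : End → End → End
  (f −E g) v k = f v k - g v k

  _∙E_ : Carrier → End → End
  (λ' ∙E f) v k = λ' * f v k

  _∘E_ : End → End → End
  (f ∘E g) v = f (g v)

  ⟦_,_⟧ : End → End → End
  ⟦ f , g ⟧ = (f ∘E g) −E (g ∘E f)

  L : Oct → End
  L x v = x · v

  eOp : Point → Point → End
  eOp P Q = quarter ∙E ⟦ L (e P) , L (e Q) ⟧

  -- X_{P_i,D}, for D one of the three lines D_i, D_{i-1}, D_{i-3} through P_i
  -- (value 0 on non-incident pairs, which never occur below).
  X : Point → Line → End
  X i D =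
    if D == i then eOp (i ⊕ 2) (i ⊕ 6) −E eOp (i ⊕ 4) (i ⊕ 5)
    else if D == (i ⊕ 6) then eOp (i ⊕ 4) (i ⊕ 5) −E eOp (i ⊕ 1) (i ⊕ 3)
    else if D == (i ⊕ 4) then eOp (i ⊕ 1) (i ⊕ 3) −E eOp (i ⊕ 2) (i ⊕ 6)
    else 0E

-- Each X_{P,D} is a quarter of an integer 8×8 matrix, namely an integer
-- combination of commutators of the signed permutation matrices of the left
-- multiplications L_{e_P}. A bracket of two X's is therefore 1/16 of an
-- integer matrix commutator, and the four identities become finitely many
-- identities between integer matrices, indexed by the 7 points and 7 lines,
-- which are decided by evaluation. They hold over any field of characteristic
-- other than 2 by applying the ring homomorphism ℤ → 𝔽, where 4 · ¼ = 1.

module Submission where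

open import Defs
open import Level using (Level)
open import Algebra.Bundles using (CommutativeRing)
open import Data.Bool using (true; false; if_then_else_)
open import Data.Fin using (Fin; zero; suc)
open import Data.Fin.Properties using (_≟_; all?)
open import Data.Integer as ℤ using (ℤ; +_; -[1+_]; 0ℤ; 1ℤ; -1ℤ; _⊖_; _◃_; ∣_∣)
import Data.Integer.Properties as ℤ
import Algebra.Properties.Monoid.Sum ℤ.+-0-monoid as ℤSum
open import Data.Nat as ℕ using (ℕ)
import Data.Nat.Properties as ℕ
open import Data.Product using (_×_; _,_; proj₂)
open import Data.Sign as Sign using (Sign)
open import Data.Sum using (_⊎_)
open import Data.Vec using (lookup; tabulate)
open import Data.Vec.Properties using (lookup∘tabulate)
open import Relation.Binary.PropositionalEquality as ≡ using (_≡_; _≢_)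
open import Relation.Nullary using (Dec; does; ¬_; ¬?)
open import Relation.Nullary.Decidable using (T?; _→-dec_; _⊎-dec_; toWitness)

variable
  m n p : ℕ

Matrix : ℕ → ℕ → Set
Matrix m n = Fin m → Fin n → ℤ

infixl 7 _⊗_ _⊛_
infixl 6 _⊖ᴹ_

_⊗_ : Matrix m n → Matrix n p → Matrix m p
(A ⊗ B) i j = ℤSum.sum λ l → A i l ℤ.* B l j

_⊖ᴹ_ : Matrix m n → Matrix m n → Matrix m n
(A ⊖ᴹ B) i j = A i j ℤ.- B i j

_⊛_ : ℤ → Matrix m n → Matrix m n
(c ⊛ A) i j = c ℤ.* A i j

𝟘 : Matrix m n
𝟘 i j = 0ℤ

[_,_]ᴹ : Matrix n n → Matrix n n → Matrix n n
[ A , B ]ᴹ = A ⊗ B ⊖ᴹ B ⊗ A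

infix 4 _≋_ _≋?_

_≋_ : Matrix m n → Matrix m n → Set
A ≋ B = ∀ i j → A i j ≡ B i j

≋-sym : {A B : Matrix m n} → A ≋ B → B ≋ A
≋-sym A≋B i j = ≡.sym (A≋B i j)

_≋?_ : (A B : Matrix m n) → Dec (A ≋ B)
A ≋? B = all? λ i → all? λ j → A i j ℤ.≟ B i j

-- Agda's evaluator shares the vector built by tabulate, so a memoised
-- function passed to a decision procedure computes each value only once.
memo : ∀ {a} {A : Set a} {n} → (Fin n → A) → Fin n → A
memo f = lookup (tabulate f)

memoMatrix : Matrix m n → Matrix m n
memoMatrix M = memo λ i → memo (M i)

memo-≡ : ∀ {a} {A : Set a} {n} (f : Fin n → A) i → memo f i ≡ f i
memo-≡ = lookup∘tabulate

memoMatrix-≋ : ∀ (M : Matrix m n) → memoMatrix M ≋ M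
memoMatrix-≋ M i j =
  ≡.trans (≡.cong (λ row → row j) (memo-≡ (λ i → memo (M i)) i)) (memo-≡ (M i) j)

module IntegerCast {c ℓ} (R : CommutativeRing c ℓ) where
  open CommutativeRing R hiding (zero)
  open import Algebra.Properties.Ring ring using (-0#≈0#; -‿involutive; -‿+-comm; -1*x≈-x)
  open import Algebra.Properties.Semiring.Mult semiring using (×-homo-+; ×1-homo-*) renaming (_×_ to _×ₙ_)
  open import Algebra.Properties.Semiring.Sum semiring using (sum)
  import Algebra.Properties.CommutativeSemigroup +-commutativeSemigroup as +-CS
  import Algebra.Properties.CommutativeSemigroup *-commutativeSemigroup as *-CS
  open import Relation.Binary.Reasoning.Setoid setoid

  ι : ℤ → Carrier
  ι (+ n)    = n ×ₙ 1#
  ι -[1+ n ] = - (ℕ.suc n ×ₙ 1#)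

  ι-⊖ : ∀ m n → ι (m ⊖ n) ≈ m ×ₙ 1# - n ×ₙ 1#
  ι-⊖ m          ℕ.zero     = sym (trans (+-congˡ -0#≈0#) (+-identityʳ _))
  ι-⊖ ℕ.zero     (ℕ.suc n)  = sym (+-identityˡ _)
  ι-⊖ (ℕ.suc m)  (ℕ.suc n)  = begin
    ι (ℕ.suc m ⊖ ℕ.suc n)          ≡⟨ ≡.cong ι (ℤ.[1+m]⊖[1+n]≡m⊖n m n) ⟩
    ι (m ⊖ n)                      ≈⟨ ι-⊖ m n ⟩
    M - N                          ≈⟨ +-identityˡ (M - N) ⟨
    0# + (M - N)                   ≈⟨ +-congʳ (-‿inverseʳ 1#) ⟨
    (1# - 1#) + (M + - N)          ≈⟨ +-CS.interchange 1# (- 1#) M (- N) ⟩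
    (1# + M) + (- 1# + - N)        ≈⟨ +-congˡ (-‿+-comm 1# N) ⟩
    (1# + M) - (1# + N)            ∎
    where
    M = m ×ₙ 1#
    N = n ×ₙ 1#

  ι-+ : ∀ i j → ι (i ℤ.+ j) ≈ ι i + ι j
  ι-+ (+ m)     (+ n)      = ×-homo-+ 1# m n
  ι-+ (+ m)     -[1+ n ]   = ι-⊖ m (ℕ.suc n)
  ι-+ -[1+ m ]  (+ n)      = trans (ι-⊖ n (ℕ.suc m)) (+-comm _ _)
  ι-+ -[1+ m ]  -[1+ n ]   = begin
    - (ℕ.suc (ℕ.suc (m ℕ.+ n)) ×ₙ 1#)         ≡⟨ ≡.cong (λ k → - (k ×ₙ 1#)) (ℕ.+-suc (ℕ.suc m) n) ⟨
    - ((ℕ.suc m ℕ.+ ℕ.suc n) ×ₙ 1#)          ≈⟨ -‿cong (×-homo-+ 1# (ℕ.suc m) (ℕ.suc n)) ⟩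
    - (ℕ.suc m ×ₙ 1# + ℕ.suc n ×ₙ 1#)       ≈⟨ -‿+-comm _ _ ⟨
    - (ℕ.suc m ×ₙ 1#) + - (ℕ.suc n ×ₙ 1#)   ∎

  ι-neg : ∀ i → ι (ℤ.- i) ≈ - ι i
  ι-neg -[1+ n ]      = sym (-‿involutive _)
  ι-neg (+ ℕ.zero)    = sym -0#≈0#
  ι-neg (+ ℕ.suc n)   = refl

  ι-- : ∀ i j → ι (i ℤ.- j) ≈ ι i - ι j
  ι-- i j = trans (ι-+ i (ℤ.- j)) (+-congˡ (ι-neg j))

  σ : Sign → Carrier
  σ Sign.+ = 1#
  σ Sign.- = - 1#

  σ-* : ∀ s t → σ (s Sign.* t) ≈ σ s * σ t
  σ-* Sign.+ t      = sym (*-identityˡ _)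
  σ-* Sign.- Sign.+ = sym (*-identityʳ _)
  σ-* Sign.- Sign.- = sym (trans (-1*x≈-x (- 1#)) (-‿involutive 1#))

  ι-◃ : ∀ s n → ι (s ◃ n) ≈ σ s * (n ×ₙ 1#)
  ι-◃ s      ℕ.zero    = sym (zeroʳ _)
  ι-◃ Sign.+ (ℕ.suc n) = sym (*-identityˡ _)
  ι-◃ Sign.- (ℕ.suc n) = sym (-1*x≈-x _)

  ι-signAbs : ∀ i → ι i ≈ σ (ℤ.sign i) * (∣ i ∣ ×ₙ 1#)
  ι-signAbs i = trans (reflexive (≡.cong ι (≡.sym (ℤ.◃-inverse i)))) (ι-◃ (ℤ.sign i) ∣ i ∣)

  ι-* : ∀ i j → ι (i ℤ.* j) ≈ ι i * ι j
  ι-* i j = begin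
    ι (i ℤ.* j)                              ≈⟨ ι-◃ (s Sign.* t) (∣ i ∣ ℕ.* ∣ j ∣) ⟩
    σ (s Sign.* t) * ((∣ i ∣ ℕ.* ∣ j ∣) ×ₙ 1#)  ≈⟨ *-cong (σ-* s t) (×1-homo-* ∣ i ∣ ∣ j ∣) ⟩
    (σ s * σ t) * (∣ i ∣ ×ₙ 1# * ∣ j ∣ ×ₙ 1#)   ≈⟨ *-CS.interchange _ _ _ _ ⟩
    (σ s * ∣ i ∣ ×ₙ 1#) * (σ t * ∣ j ∣ ×ₙ 1#)   ≈⟨ *-cong (ι-signAbs i) (ι-signAbs j) ⟨
    ι i * ι j                                ∎
    where
    s = ℤ.sign i
    t = ℤ.sign j

  ι-sum : ∀ {n} (f : Fin n → ℤ) → ι (ℤSum.sum f) ≈ sum (λ i → ι (f i))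
  ι-sum {ℕ.zero}  f = refl
  ι-sum {ℕ.suc n} f = trans (ι-+ (f zero) _) (+-congˡ (ι-sum (λ i → f (suc i))))

module MatrixAction {c ℓ} (R : CommutativeRing c ℓ) where
  open CommutativeRing R hiding (zero)
  open IntegerCast R
  open import Algebra.Properties.Ring ring using (-1*x≈-x)
  open import Algebra.Properties.Semiring.Sum semiring
    using (sum; sum-cong-≋; sum-replicate-zero; ∑-comm; ∑-distrib-+; *-distribˡ-sum; *-distribʳ-sum)
  import Algebra.Properties.CommutativeSemigroup *-commutativeSemigroup as *-CS
  open import Relation.Binary.Reasoning.Setoid setoid

  act : Matrix m n → (Fin n → Carrier) → Fin m → Carrier
  act M v i = sum λ j → ι (M i j) * v j

  act-cong : ∀ {A B : Matrix m n} → A ≋ B → ∀ v i → act A v i ≈ act B v i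
  act-cong A≋B v i = sum-cong-≋ λ j → *-congʳ (reflexive (≡.cong ι (A≋B i j)))

  act-respects : ∀ (A : Matrix m n) {v w} → (∀ j → v j ≈ w j) → ∀ i → act A v i ≈ act A w i
  act-respects A v≈w i = sum-cong-≋ λ j → *-congˡ (v≈w j)

  act-homogeneous : ∀ (A : Matrix m n) a v i → act A (λ j → a * v j) i ≈ a * act A v i
  act-homogeneous A a v i = begin
    sum (λ j → ι (A i j) * (a * v j))  ≈⟨ sum-cong-≋ (λ j → *-CS.x∙yz≈y∙xz (ι (A i j)) a (v j)) ⟩
    sum (λ j → a * (ι (A i j) * v j))  ≈⟨ *-distribˡ-sum a (λ j → ι (A i j) * v j) ⟨
    a * act A v i                      ∎

  act-⊗ : ∀ (A : Matrix m n) (B : Matrix n p) v i → act (A ⊗ B) v i ≈ act A (act B v) i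
  act-⊗ A B v i = begin
    sum (λ l → ι ((A ⊗ B) i l) * v l)
      ≈⟨ sum-cong-≋ (λ l → *-congʳ (trans (ι-sum (λ j → A i j ℤ.* B j l))
                                          (sum-cong-≋ λ j → ι-* (A i j) (B j l)))) ⟩
    sum (λ l → sum (λ j → ι (A i j) * ι (B j l)) * v l)
      ≈⟨ sum-cong-≋ (λ l → trans (*-distribʳ-sum (v l) (λ j → ι (A i j) * ι (B j l)))
                                 (sum-cong-≋ λ j → *-assoc (ι (A i j)) (ι (B j l)) (v l))) ⟩
    sum (λ l → sum (λ j → ι (A i j) * (ι (B j l) * v l)))
      ≈⟨ ∑-comm (λ l j → ι (A i j) * (ι (B j l) * v l)) ⟩
    sum (λ j → sum (λ l → ι (A i j) * (ι (B j l) * v l)))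
      ≈⟨ sum-cong-≋ (λ j → *-distribˡ-sum (ι (A i j)) (λ l → ι (B j l) * v l)) ⟨
    act A (act B v) i ∎

  act-⊖ : ∀ (A B : Matrix m n) v i → act (A ⊖ᴹ B) v i ≈ act A v i - act B v i
  act-⊖ A B v i = begin
    sum (λ j → ι (A i j ℤ.- B i j) * v j)
      ≈⟨ sum-cong-≋ (λ j → trans (*-congʳ (ι-- (A i j) (B i j)))
                                 (distribʳ (v j) (ι (A i j)) (- ι (B i j)))) ⟩
    sum (λ j → ι (A i j) * v j + - ι (B i j) * v j)
      ≈⟨ ∑-distrib-+ (λ j → ι (A i j) * v j) (λ j → - ι (B i j) * v j) ⟩
    act A v i + sum (λ j → - ι (B i j) * v j)
      ≈⟨ +-congˡ (sum-cong-≋ λ j → trans (*-congʳ (sym (-1*x≈-x (ι (B i j)))))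
                                          (*-assoc (- 1#) (ι (B i j)) (v j))) ⟩
    act A v i + sum (λ j → - 1# * (ι (B i j) * v j))
      ≈⟨ +-congˡ (trans (sym (*-distribˡ-sum (- 1#) (λ j → ι (B i j) * v j))) (-1*x≈-x _)) ⟩
    act A v i - act B v i ∎

  act-⊛ : ∀ c (A : Matrix m n) v i → act (c ⊛ A) v i ≈ ι c * act A v i
  act-⊛ c A v i = begin
    sum (λ j → ι (c ℤ.* A i j) * v j)
      ≈⟨ sum-cong-≋ (λ j → trans (*-congʳ (ι-* c (A i j))) (*-assoc (ι c) (ι (A i j)) (v j))) ⟩
    sum (λ j → ι c * (ι (A i j) * v j))
      ≈⟨ *-distribˡ-sum (ι c) (λ j → ι (A i j) * v j) ⟨
    ι c * act A v i ∎

  act-𝟘 : ∀ v (i : Fin m) → act {n = n} 𝟘 v i ≈ 0#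
  act-𝟘 {n = n} v i = trans (sum-cong-≋ λ j → zeroˡ (v j)) (sum-replicate-zero n)

  sum-δ : ∀ {n} (i : Fin n) (x : Fin n → Carrier) →
          sum (λ a → (if does (a ≟ i) then 1# else 0#) * x a) ≈ x i
  sum-δ {ℕ.suc n} zero x = begin
    1# * x zero + sum (λ a → 0# * x (suc a))  ≈⟨ +-cong (*-identityˡ _) (sum-cong-≋ λ a → zeroˡ (x (suc a))) ⟩
    x zero + sum {n} (λ a → 0#)               ≈⟨ +-congˡ (sum-replicate-zero n) ⟩
    x zero + 0#                               ≈⟨ +-identityʳ _ ⟩
    x zero                                    ∎
  sum-δ {ℕ.suc n} (suc i) x =
    trans (+-cong (zeroˡ (x zero)) (sum-δ i (λ a → x (suc a)))) (+-identityˡ _)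

-- Integer copies of ε, sign and idx from Octonions, which are only defined
-- once a field has been fixed.
εℤ : Point → Point → ℤ
εℤ P Q = if posB (diff Q P) then 1ℤ else -1ℤ

basisSign : Fin 8 → Fin 8 → ℤ
basisSign zero    b       = 1ℤ
basisSign (suc P) zero    = 1ℤ
basisSign (suc P) (suc Q) = if P == Q then -1ℤ else εℤ P Q

basisIndex : Fin 8 → Fin 8 → Fin 8
basisIndex zero    b       = b
basisIndex (suc P) zero    = suc P
basisIndex (suc P) (suc Q) = if P == Q then zero else suc (P +ₚ Q)

leftMulMatrix : Point → Matrix 8 8
leftMulMatrix P k b = if does (basisIndex (suc P) b ≟ k) then basisSign (suc P) b else 0ℤ

xMatrix : (Point → Matrix 8 8) → Point → Line → Matrix 8 8
xMatrix L i D =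
  if D == i then [ L (i ⊕ 2) , L (i ⊕ 6) ]ᴹ ⊖ᴹ [ L (i ⊕ 4) , L (i ⊕ 5) ]ᴹ
  else if D == (i ⊕ 6) then [ L (i ⊕ 4) , L (i ⊕ 5) ]ᴹ ⊖ᴹ [ L (i ⊕ 1) , L (i ⊕ 3) ]ᴹ
  else if D == (i ⊕ 4) then [ L (i ⊕ 1) , L (i ⊕ 3) ]ᴹ ⊖ᴹ [ L (i ⊕ 2) , L (i ⊕ 6) ]ᴹ
  else 𝟘

leftMulTable : Point → Matrix 8 8
leftMulTable = memo λ P → memoMatrix (leftMulMatrix P)

leftMulTable-≋ : ∀ P → leftMulTable P ≋ leftMulMatrix P
leftMulTable-≋ P i j = ≡.trans (≡.cong (λ M → M i j) (memo-≡ (λ P → memoMatrix (leftMulMatrix P)) P))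
                               (memoMatrix-≋ (leftMulMatrix P) i j)

xTable : Point → Line → Matrix 8 8
xTable = memo λ P → memo λ D → memoMatrix (xMatrix leftMulTable P D)

xTable-≋ : ∀ P D → xTable P D ≋ xMatrix leftMulTable P D
xTable-≋ P D i j = begin
  xTable P D i j
    ≡⟨ ≡.cong (λ row → row D i j) (memo-≡ (λ P → memo λ D → memoMatrix (xMatrix leftMulTable P D)) P) ⟩
  memo (λ D → memoMatrix (xMatrix leftMulTable P D)) D i j
    ≡⟨ ≡.cong (λ M → M i j) (memo-≡ (λ D → memoMatrix (xMatrix leftMulTable P D)) D) ⟩
  memoMatrix (xMatrix leftMulTable P D) i j
    ≡⟨ memoMatrix-≋ (xMatrix leftMulTable P D) i j ⟩
  xMatrix leftMulTable P D i j ∎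
  where open ≡.≡-Reasoning

-- Since X = ¼·xMatrix, a bracket [X,X'] = c·X'' of operators reads
-- [A,A'] = 4c·A'' on the integer matrices.
module _ (X : Point → Line → Matrix 8 8) where

  SharedPointLaw : Set
  SharedPointLaw = ∀ P D P' D' → P ∈ₗ D → P' ∈ₗ D' → P ≡ P' → D ≢ D' →
    [ X P D , X P' D' ]ᴹ ≋ 𝟘

  SharedLineLaw : Set
  SharedLineLaw = ∀ P D P' D' → P ∈ₗ D → P' ∈ₗ D' → P ≢ P' → D ≡ D' →
    [ X P D , X P' D' ]ᴹ ≋ (+ 4 ℤ.* (+ 2 ℤ.* εℤ P P')) ⊛ X (P +ₚ P') (P ∧ₚ P')

  CrossIncidentLaw : Set
  CrossIncidentLaw = ∀ P D P' D' → P ∈ₗ D → P' ∈ₗ D' → P ≢ P' → D ≢ D' →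
    (P ∈ₗ D' ⊎ P' ∈ₗ D) →
    [ X P D , X P' D' ]ᴹ ≋ (+ 4 ℤ.* ℤ.- εℤ P P') ⊛ X (P +ₚ P') (P ∧ₚ P')

  SkewLaw : Set
  SkewLaw = ∀ P D P' D' → P ∈ₗ D → P' ∈ₗ D' → P ≢ P' → D ≢ D' →
    ¬ (P ∈ₗ D') → ¬ (P' ∈ₗ D) →
    [ X P D , X P' D' ]ᴹ ≋ (+ 4 ℤ.* ℤ.- εℤ P P') ⊛ X (P +ₚ P') (D +ₗ D')

  sharedPointLaw? : Dec SharedPointLaw
  sharedPointLaw? = all? λ P → all? λ D → all? λ P' → all? λ D' →
    T? (incB P D) →-dec T? (incB P' D') →-dec P ≟ P' →-dec ¬? (D ≟ D') →-dec
    [ X P D , X P' D' ]ᴹ ≋? 𝟘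

  sharedLineLaw? : Dec SharedLineLaw
  sharedLineLaw? = all? λ P → all? λ D → all? λ P' → all? λ D' →
    T? (incB P D) →-dec T? (incB P' D') →-dec ¬? (P ≟ P') →-dec D ≟ D' →-dec
    [ X P D , X P' D' ]ᴹ ≋? (+ 4 ℤ.* (+ 2 ℤ.* εℤ P P')) ⊛ X (P +ₚ P') (P ∧ₚ P')

  crossIncidentLaw? : Dec CrossIncidentLaw
  crossIncidentLaw? = all? λ P → all? λ D → all? λ P' → all? λ D' →
    T? (incB P D) →-dec T? (incB P' D') →-dec ¬? (P ≟ P') →-dec ¬? (D ≟ D') →-dec
    (T? (incB P D') ⊎-dec T? (incB P' D)) →-dec
    [ X P D , X P' D' ]ᴹ ≋? (+ 4 ℤ.* ℤ.- εℤ P P') ⊛ X (P +ₚ P') (P ∧ₚ P')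

  skewLaw? : Dec SkewLaw
  skewLaw? = all? λ P → all? λ D → all? λ P' → all? λ D' →
    T? (incB P D) →-dec T? (incB P' D') →-dec ¬? (P ≟ P') →-dec ¬? (D ≟ D') →-dec
    ¬? (T? (incB P D')) →-dec ¬? (T? (incB P' D)) →-dec
    [ X P D , X P' D' ]ᴹ ≋? (+ 4 ℤ.* ℤ.- εℤ P P') ⊛ X (P +ₚ P') (D +ₗ D')

xTable-sharedPoint : SharedPointLaw xTable
xTable-sharedPoint = toWitness {a? = sharedPointLaw? xTable} _

xTable-sharedLine : SharedLineLaw xTable
xTable-sharedLine = toWitness {a? = sharedLineLaw? xTable} _

xTable-crossIncident : CrossIncidentLaw xTable
xTable-crossIncident = toWitness {a? = crossIncidentLaw? xTable} _

xTable-skew : SkewLaw xTable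
xTable-skew = toWitness {a? = skewLaw? xTable} _

module Representation {c ℓ} (F : Field c ℓ)
    (char≢2 : ¬ (Field._≈_ F (Field._+_ F (Field.1# F) (Field.1# F)) (Field.0# F))) where
  open Field F hiding (zero)
  open Octonions F char≢2
  open IntegerCast commutativeRing
  open MatrixAction commutativeRing
  open import Algebra.Properties.Ring ring using (-‿distribʳ-*)
  open import Algebra.Properties.Semiring.Sum semiring using (sum; sum-cong-≋; *-distribˡ-sum)
  import Algebra.Properties.CommutativeSemigroup *-commutativeSemigroup as *-CS
  open import Algebra.Solver.CommutativeMonoid *-commutativeMonoid using (solve; _⊜_) renaming (_⊕_ to _⊕′_)
  open import Relation.Binary.Reasoning.Setoid setoid

  ⟪_⟫ : Matrix 8 8 → End
  ⟪ M ⟫ = act M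

  ι-ε : ∀ P Q → ι (εℤ P Q) ≈ ε P Q
  ι-ε P Q with posB (diff Q P)
  ... | true  = +-identityʳ 1#
  ... | false = -‿cong (+-identityʳ 1#)

  ι-basisSign : ∀ a b → ι (basisSign a b) ≈ sign a b
  ι-basisSign zero    b       = +-identityʳ 1#
  ι-basisSign (suc P) zero    = +-identityʳ 1#
  ι-basisSign (suc P) (suc Q) with P == Q
  ... | true  = -‿cong (+-identityʳ 1#)
  ... | false = ι-ε P Q

  L-e≐leftMulMatrix : ∀ P → L (e P) ≐ ⟪ leftMulMatrix P ⟫
  -- On Fin 8, Σ8 from Defs and the library's sum unfold to the same term.
  L-e≐leftMulMatrix P v k = begin
    sum (λ a → sum (λ b → if eq8 (idx a b) k then sign a b * (e P a * v b) else 0#))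
      ≈⟨ sum-cong-≋ (λ a → trans (sum-cong-≋ λ b → if-*ˡ (eq8 (idx a b) k) (sign a b) (e P a) (v b))
                                  (sym (*-distribˡ-sum (e P a) (row a)))) ⟩
    sum (λ a → e P a * sum (row a))
      ≈⟨ sum-δ (suc P) (λ a → sum (row a)) ⟩
    sum (row (suc P))
      ≈⟨ sum-cong-≋ entry ⟩
    ⟪ leftMulMatrix P ⟫ v k ∎
    where
    row : Fin 8 → Fin 8 → Carrier
    row a b = if eq8 (idx a b) k then sign a b * v b else 0#

    if-*ˡ : ∀ b s d w → (if b then s * (d * w) else 0#) ≈ d * (if b then s * w else 0#)
    if-*ˡ true  s d w = *-CS.x∙yz≈y∙xz s d w
    if-*ˡ false s d w = sym (zeroʳ d)

    ι-if : ∀ b z s w → ι z ≈ s → (if b then s * w else 0#) ≈ ι (if b then z else 0ℤ) * w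
    ι-if true  z s w ιz≈s = *-congʳ (sym ιz≈s)
    ι-if false z s w ιz≈s = sym (zeroˡ w)

    -- idx and basisIndex agree definitionally only once b is split.
    entry : ∀ b → row (suc P) b ≈ ι (leftMulMatrix P k b) * v b
    entry zero    = ι-if (eq8 (suc P) k) 1ℤ 1# (v zero) (+-identityʳ 1#)
    entry (suc Q) = ι-if (eq8 (idx (suc P) (suc Q)) k) (basisSign (suc P) (suc Q))
                         (sign (suc P) (suc Q)) (v (suc Q)) (ι-basisSign (suc P) (suc Q))

  record Represented (f : End) (a : Carrier) (A : Matrix 8 8) : Set (c Level.⊔ ℓ) where
    constructor represented
    field action : f ≐ (a ∙E ⟪ A ⟫)
  open Represented

  represented-∘ : ∀ {f g a b A B} → Represented f a A → Represented g b B →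
                  Represented (f ∘E g) (a * b) (A ⊗ B)
  represented-∘ {f} {g} {a} {b} {A} {B} (represented f≐) (represented g≐) = represented λ v k → begin
    f (g v) k                           ≈⟨ f≐ (g v) k ⟩
    a * ⟪ A ⟫ (g v) k                   ≈⟨ *-congˡ (act-respects A (g≐ v) k) ⟩
    a * ⟪ A ⟫ (λ j → b * ⟪ B ⟫ v j) k   ≈⟨ *-congˡ (act-homogeneous A b (⟪ B ⟫ v) k) ⟩
    a * (b * ⟪ A ⟫ (⟪ B ⟫ v) k)         ≈⟨ *-assoc a b _ ⟨
    (a * b) * ⟪ A ⟫ (⟪ B ⟫ v) k         ≈⟨ *-congˡ (act-⊗ A B v k) ⟨
    (a * b) * ⟪ A ⊗ B ⟫ v k             ∎

  represented-− : ∀ {f g a A B} → Represented f a A → Represented g a B →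
                  Represented (f −E g) a (A ⊖ᴹ B)
  represented-− {f} {g} {a} {A} {B} (represented f≐) (represented g≐) = represented λ v k → begin
    f v k - g v k                    ≈⟨ +-cong (f≐ v k) (-‿cong (g≐ v k)) ⟩
    a * ⟪ A ⟫ v k - a * ⟪ B ⟫ v k    ≈⟨ +-congˡ (-‿distribʳ-* a _) ⟩
    a * ⟪ A ⟫ v k + a * - ⟪ B ⟫ v k  ≈⟨ distribˡ a _ _ ⟨
    a * (⟪ A ⟫ v k - ⟪ B ⟫ v k)      ≈⟨ *-congˡ (act-⊖ A B v k) ⟨
    a * ⟪ A ⊖ᴹ B ⟫ v k               ∎

  represented-⟦⟧ : ∀ {f g a A B} → Represented f a A → Represented g a B →
                   Represented ⟦ f , g ⟧ (a * a) [ A , B ]ᴹ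
  represented-⟦⟧ f~A g~B = represented-− (represented-∘ f~A g~B) (represented-∘ g~B f~A)

  represented-∙ : ∀ {f a A} b → Represented f a A → Represented (b ∙E f) (b * a) A
  represented-∙ b (represented f≐) = represented λ v k → trans (*-congˡ (f≐ v k)) (sym (*-assoc _ _ _))

  represented-≈ : ∀ {f a b A} → a ≈ b → Represented f a A → Represented f b A
  represented-≈ a≈b (represented f≐) = represented λ v k → trans (f≐ v k) (*-congʳ a≈b)

  represented-≋ : ∀ {f a A B} → A ≋ B → Represented f a A → Represented f a B
  represented-≋ A≋B (represented f≐) = represented λ v k → trans (f≐ v k) (*-congˡ (act-cong A≋B v k))

  represented-0E : ∀ a → Represented 0E a 𝟘
  represented-0E a = represented λ v k → sym (trans (*-congˡ (act-𝟘 v k)) (zeroʳ a))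

  represented-if : ∀ b {f g a A B} → Represented f a A → Represented g a B →
                   Represented (if b then f else g) a (if b then A else B)
  represented-if true  f~A g~B = f~A
  represented-if false f~A g~B = g~B

  represented-L : ∀ P → Represented (L (e P)) 1# (leftMulTable P)
  represented-L P = represented λ v k →
    trans (L-e≐leftMulMatrix P v k) (trans (act-cong (≋-sym (leftMulTable-≋ P)) v k) (sym (*-identityˡ _)))

  represented-eOp : ∀ P Q → Represented (eOp P Q) quarter [ leftMulTable P , leftMulTable Q ]ᴹ
  represented-eOp P Q = represented-≈ (trans (*-congˡ (*-identityˡ 1#)) (*-identityʳ quarter))
    (represented-∙ quarter (represented-⟦⟧ (represented-L P) (represented-L Q)))

  represented-X : ∀ i D → Represented (X i D) quarter (xTable i D)
  represented-X i D = represented-≋ (≋-sym (xTable-≋ i D))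
    (represented-if (D == i) (pair (i ⊕ 2) (i ⊕ 6) (i ⊕ 4) (i ⊕ 5))
    (represented-if (D == (i ⊕ 6)) (pair (i ⊕ 4) (i ⊕ 5) (i ⊕ 1) (i ⊕ 3))
    (represented-if (D == (i ⊕ 4)) (pair (i ⊕ 1) (i ⊕ 3) (i ⊕ 2) (i ⊕ 6))
    (represented-0E quarter))))
    where
    pair : ∀ P Q P' Q' → Represented (eOp P Q −E eOp P' Q') quarter
                           ([ leftMulTable P , leftMulTable Q ]ᴹ ⊖ᴹ [ leftMulTable P' , leftMulTable Q' ]ᴹ)
    pair P Q P' Q' = represented-− (represented-eOp P Q) (represented-eOp P' Q')

  four*quarter≈1 : ι (+ 4) * quarter ≈ 1#
  four*quarter≈1 = begin
    ι (+ 4) * quarter            ≈⟨ *-congʳ four≈two*two ⟩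
    (two * two) * (half * half)  ≈⟨ *-CS.interchange two two half half ⟩
    (two * half) * (two * half)  ≈⟨ *-cong two*half≈1 two*half≈1 ⟩
    1# * 1#                      ≈⟨ *-identityʳ 1# ⟩
    1#                           ∎
    where
    two*half≈1 : two * half ≈ 1#
    two*half≈1 = proj₂ (inverse two char≢2)
    four≈two*two : ι (+ 4) ≈ two * two
    four≈two*two = begin
      1# + (1# + (1# + (1# + 0#)))  ≈⟨ +-congˡ (+-congˡ (+-congˡ (+-identityʳ 1#))) ⟩
      1# + (1# + two)               ≈⟨ +-assoc 1# 1# two ⟨
      two + two                     ≈⟨ +-cong (*-identityʳ two) (*-identityʳ two) ⟨
      two * 1# + two * 1#           ≈⟨ distribˡ two 1# 1# ⟨
      two * two                     ∎

  bracket-vanishes : ∀ {f g A B} → Represented f quarter A → Represented g quarter B →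
                     [ A , B ]ᴹ ≋ 𝟘 → ⟦ f , g ⟧ ≐ 0E
  bracket-vanishes {f} {g} {A} {B} f~A g~B [A,B]≋0 v k = begin
    ⟦ f , g ⟧ v k                          ≈⟨ action (represented-⟦⟧ f~A g~B) v k ⟩
    (quarter * quarter) * ⟪ [ A , B ]ᴹ ⟫ v k ≈⟨ *-congˡ (trans (act-cong [A,B]≋0 v k) (act-𝟘 v k)) ⟩
    (quarter * quarter) * 0#               ≈⟨ zeroʳ _ ⟩
    0#                                     ∎

  bracket-scaled : ∀ {f g h A B C} c {a} → Represented f quarter A → Represented g quarter B →
                   Represented h quarter C → [ A , B ]ᴹ ≋ (+ 4 ℤ.* c) ⊛ C → ι c ≈ a →
                   ⟦ f , g ⟧ ≐ (a ∙E h)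
  bracket-scaled {f} {g} {h} {A} {B} {C} c {a} f~A g~B (represented h≐) [A,B]≋4cC ιc≈a v k = begin
    ⟦ f , g ⟧ v k
      ≈⟨ action (represented-⟦⟧ f~A g~B) v k ⟩
    (quarter * quarter) * ⟪ [ A , B ]ᴹ ⟫ v k
      ≈⟨ *-congˡ (trans (act-cong [A,B]≋4cC v k) (act-⊛ (+ 4 ℤ.* c) C v k)) ⟩
    (quarter * quarter) * (ι (+ 4 ℤ.* c) * ⟪ C ⟫ v k)
      ≈⟨ *-congˡ (*-congʳ (ι-* (+ 4) c)) ⟩
    (quarter * quarter) * ((ι (+ 4) * ι c) * ⟪ C ⟫ v k)
      ≈⟨ solve 5 (λ q f c' x q' → (q ⊕′ q') ⊕′ ((f ⊕′ c') ⊕′ x) ⊜ (f ⊕′ q) ⊕′ (c' ⊕′ (q' ⊕′ x)))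
               refl quarter (ι (+ 4)) (ι c) (⟪ C ⟫ v k) quarter ⟩
    (ι (+ 4) * quarter) * (ι c * (quarter * ⟪ C ⟫ v k))
      ≈⟨ *-cong four*quarter≈1 (*-cong ιc≈a (sym (h≐ v k))) ⟩
    1# * (a * h v k)
      ≈⟨ *-identityˡ _ ⟩
    a * h v k ∎

  ι-2ε : ∀ P Q → ι (+ 2 ℤ.* εℤ P Q) ≈ two * ε P Q
  ι-2ε P Q = trans (ι-* (+ 2) (εℤ P Q)) (*-cong (+-congˡ (+-identityʳ 1#)) (ι-ε P Q))

  ι-negε : ∀ P Q → ι (ℤ.- εℤ P Q) ≈ - ε P Q
  ι-negε P Q = trans (ι-neg (εℤ P Q)) (-‿cong (ι-ε P Q))

theorem3p18 : ∀ {c ℓ : Level} (F : Field c ℓ)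
    (char≢2 : ¬ (Field._≈_ F (Field._+_ F (Field.1# F) (Field.1# F)) (Field.0# F))) →
    let open Field F
        open Octonions F char≢2
    in ∀ (P : Point) (D : Line) (P' : Point) (D' : Line) → P ∈ₗ D → P' ∈ₗ D' →
       ((P ≡ P' → D ≢ D' → ⟦ X P D , X P' D' ⟧ ≐ 0E)
       × (P ≢ P' → D ≡ D' →
            ⟦ X P D , X P' D' ⟧ ≐ ((two * ε P P') ∙E X (P +ₚ P') (P ∧ₚ P')))
       × (P ≢ P' → D ≢ D' → (P ∈ₗ D' ⊎ P' ∈ₗ D) →
            ⟦ X P D , X P' D' ⟧ ≐ ((- ε P P') ∙E X (P +ₚ P') (P ∧ₚ P')))
       × (P ≢ P' → D ≢ D' → ¬ (P ∈ₗ D') → ¬ (P' ∈ₗ D) →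
            ⟦ X P D , X P' D' ⟧ ≐ ((- ε P P') ∙E X (P +ₚ P') (D +ₗ D'))))
theorem3p18 F char≢2 P D P' D' P∈D P'∈D' =
    (λ P≡P' D≢D' → bracket-vanishes (represented-X P D) (represented-X P' D')
                     (xTable-sharedPoint P D P' D' P∈D P'∈D' P≡P' D≢D'))
  , (λ P≢P' D≡D' → bracket-scaled (+ 2 ℤ.* εℤ P P') (represented-X P D) (represented-X P' D')
                     (represented-X (P +ₚ P') (P ∧ₚ P'))
                     (xTable-sharedLine P D P' D' P∈D P'∈D' P≢P' D≡D') (ι-2ε P P'))
  , (λ P≢P' D≢D' incident → bracket-scaled (ℤ.- εℤ P P') (represented-X P D) (represented-X P' D')
                     (represented-X (P +ₚ P') (P ∧ₚ P'))
                     (xTable-crossIncident P D P' D' P∈D P'∈D' P≢P' D≢D' incident) (ι-negε P P'))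
  , (λ P≢P' D≢D' P∉D' P'∉D → bracket-scaled (ℤ.- εℤ P P') (represented-X P D) (represented-X P' D')
                     (represented-X (P +ₚ P') (D +ₗ D'))
                     (xTable-skew P D P' D' P∈D P'∈D' P≢P' D≢D' P∉D' P'∉D) (ι-negε P P'))
  where open Representation F char≢2
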